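{- Let $t=-1$. For every integer $n\ge1$, $$\sum_{k=0}^n\left\{ n\atop k\right\}_{s,-1}=(1+\delta_O(n))\prod_{i=1}^{\lfloor n/2\rfloor}\bigl(2+\langle n-2i+1\rangle\bigr)$$ and $$\sum_{k=0}^n(-1)^k\left\{ n\atop k\right\}_{s,-1}=\delta_E(n)\prod_{i=1}^{\lfloor n/2\rfloor}\bigl(2-\langle n-2i+1\rangle\bigr),$$ where $\langle m\rangle=\langle m\rangle_{s,-1}$.
   Context: Let $s$ be an indeterminate and $t=-1$. $\{n\}_{s,-1}$ is defined by $\{0\}=0$, $\{1\}=1$, $\{n\}=s\{n-1\}-\{n-2\}$ for $n\ge2$; $\{n\}!=\{1\}\cdots\{n\}$ and $\left\{ n\atop k\right\}_{s,-1}=\frac{\{n\}!}{\{k\}!\{n-k\}!}$. The generalized Lucas polynomials $\langle m\rangle_{s,-1}$ are defined by $\langle0\rangle=2$, $\langle 1\rangle=s$, $\langle m\rangle=s\langle m-1\rangle-\langle m-2\rangle$ for $m\ge2$. $\delta_O(n)=1$ if $n$ is odd and $0$ otherwise; $\delta_E(n)=1$ if $n$ is even and $0$ otherwise. Empty products equal $1$. -}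

module Defs where

open import Data.Nat as ℕ using (ℕ; zero; suc; _∸_; ⌊_/2⌋)
open import Data.Integer as ℤ using (ℤ; +_; -[1+_])
open import Relation.Binary.PropositionalEquality using (_≡_)

-- Formal power series in the indeterminate s with integer coefficients:
-- a series is its coefficient function.  ℤ[s] embeds in ℤ[[s]], and both
-- are integral domains, so polynomial identities may be checked here.
Series : Set
Series = ℕ → ℤ

infix 4 _≈_
_≈_ : Series → Series → Set
f ≈ g = ∀ m → f m ≡ g m

C : ℤ → Series
C c zero    = c
C c (suc _) = + 0

S : Series
S (suc zero) = + 1
S _          = + 0

infixl 6 _⊕_ _⊖_
infixl 7 _⊛_

_⊕_ : Series → Series → Series
(f ⊕ g) m = f m ℤ.+ g m

_⊖_ : Series → Series → Series
(f ⊖ g) m = f m ℤ.- g m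

sumℤ : ℕ → (ℕ → ℤ) → ℤ
sumℤ zero    a = a 0
sumℤ (suc m) a = sumℤ m a ℤ.+ a (suc m)

_⊛_ : Series → Series → Series
(f ⊛ g) m = sumℤ m (λ i → f i ℤ.* g (m ∸ i))

sumS : ℕ → (ℕ → Series) → Series
sumS zero    F = F 0
sumS (suc n) F = sumS n F ⊕ F (suc n)

prod1 : ℕ → (ℕ → Series) → Series
prod1 zero    F = C (+ 1)
prod1 (suc N) F = prod1 N F ⊛ F (suc N)

brace : ℕ → Series
brace zero          = C (+ 0)
brace (suc zero)    = C (+ 1)
brace (suc (suc n)) = S ⊛ brace (suc n) ⊖ brace n

braceFact : ℕ → Series
braceFact n = prod1 n brace

luc : ℕ → Series
luc zero          = C (+ 2)
luc (suc zero)    = S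
luc (suc (suc m)) = S ⊛ luc (suc m) ⊖ luc m

-- L is the family of lucanomials {n k}_{s,-1} = {n}!/({k}!{n-k}!):
-- the (unique, since ℤ[[s]] is a domain and {j}! ≠ 0) quotient.
IsLucanomial : (ℕ → ℕ → Series) → Set
IsLucanomial L = ∀ n k → k ℕ.≤ n → braceFact k ⊛ braceFact (n ∸ k) ⊛ L n k ≈ braceFact n

δO : ℕ → ℤ
δO zero          = + 0
δO (suc zero)    = + 1
δO (suc (suc n)) = δO n

δE : ℕ → ℤ
δE zero          = + 1
δE (suc zero)    = + 0
δE (suc (suc n)) = δE n

sgn : ℕ → ℤ
sgn zero          = + 1
sgn (suc zero)    = -[1+ 0 ]
sgn (suc (suc k)) = sgn k

-- The lucanomials satisfy the three-term recurrence {n+2 k} = {n k} + ⟨n+1⟩{n k-1} + {n k-2}.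
-- Cleared of factorials this is a quadratic identity between braces and Lucas polynomials,
-- which becomes linear after multiplication by the discriminant s² - 4.  Summing the recurrence
-- over k with weights 1, resp. (-1)ᵏ, gives Σ(n+2) = (2 ± ⟨n+1⟩) Σ(n), and both formulas follow
-- by induction in steps of two.  The given L agrees with the recurrence because the factorials
-- {m}! are not zero divisors in ℤ[[s]]: {m+1} has leading coefficient 1.

module Submission where

open import Defs
open import Data.Nat using (ℕ; zero; suc; _∸_; _≤_; _<_; z≤n; s≤s; ⌊_/2⌋)
import Data.Nat.Properties as ℕ
open import Data.Integer as ℤ using (ℤ; +_; -[1+_])
import Data.Integer.Properties as ℤ
open import Data.Product using (_×_; _,_)
open import Data.List using (_∷_; [])
open import Data.Maybe using (Maybe; just; nothing)
open import Data.Sum using (inj₁; inj₂)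
open import Data.Empty using (⊥-elim)
open import Relation.Nullary using (yes; no)
open import Relation.Binary.PropositionalEquality as ≡
  using (_≡_; _≢_; refl; cong; cong₂)
open import Relation.Binary.Structures using (IsEquivalence)
open import Algebra.Bundles using (CommutativeRing)
open import Algebra.Structures using (IsCommutativeRing)
import Algebra.Solver.Ring as RingSolver
import Algebra.Solver.Ring.AlmostCommutativeRing as ACR
import Relation.Binary.Reasoning.Setoid as SetoidReasoning

tl : Series → Series
tl f m = f (suc m)

neg : Series → Series
neg f m = ℤ.- f m

module CauchyProduct where

  open import Data.Integer using (_+_; _*_; -_)
  open import Data.Integer.Solver using (module +-*-Solver)
  open +-*-Solver using (solve; _:+_; _:*_; _:=_)
  open ≡ using (sym; trans)
  open ≡.≡-Reasoning

  sumℤ-cong : ∀ m {a b : ℕ → ℤ} → (∀ i → a i ≡ b i) → sumℤ m a ≡ sumℤ m b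
  sumℤ-cong zero    a≡b = a≡b 0
  sumℤ-cong (suc m) a≡b = cong₂ _+_ (sumℤ-cong m a≡b) (a≡b (suc m))

  sumℤ-+ : ∀ m (a b : ℕ → ℤ) → sumℤ m (λ i → a i + b i) ≡ sumℤ m a + sumℤ m b
  sumℤ-+ zero    a b = refl
  sumℤ-+ (suc m) a b = trans (cong (_+ (a (suc m) + b (suc m))) (sumℤ-+ m a b))
    (solve 4 (λ x y z w → (x :+ y) :+ (z :+ w) := (x :+ z) :+ (y :+ w)) refl
       (sumℤ m a) (sumℤ m b) (a (suc m)) (b (suc m)))

  sumℤ-*ˡ : ∀ m c (a : ℕ → ℤ) → sumℤ m (λ i → c * a i) ≡ c * sumℤ m a
  sumℤ-*ˡ zero    c a = refl
  sumℤ-*ˡ (suc m) c a = trans (cong (_+ (c * a (suc m))) (sumℤ-*ˡ m c a))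
    (sym (ℤ.*-distribˡ-+ c (sumℤ m a) (a (suc m))))

  sumℤ-peel : ∀ m (a : ℕ → ℤ) → sumℤ (suc m) a ≡ a 0 + sumℤ m (λ i → a (suc i))
  sumℤ-peel zero    a = refl
  sumℤ-peel (suc m) a = trans (cong (_+ a (suc (suc m))) (sumℤ-peel m a))
    (ℤ.+-assoc (a 0) (sumℤ m (λ i → a (suc i))) (a (suc (suc m))))

  sumℤ-zero : ∀ m (a : ℕ → ℤ) → (∀ i → a i ≡ + 0) → sumℤ m a ≡ + 0
  sumℤ-zero zero    a a≡0 = a≡0 0
  sumℤ-zero (suc m) a a≡0 = cong₂ _+_ (sumℤ-zero m a a≡0) (a≡0 (suc m))

  C-zero : ∀ m → C (+ 0) m ≡ + 0
  C-zero zero    = refl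
  C-zero (suc m) = refl

  ⊛-cong : ∀ {f f′ g g′} → f ≈ f′ → g ≈ g′ → f ⊛ g ≈ f′ ⊛ g′
  ⊛-cong f≈f′ g≈g′ m = sumℤ-cong m (λ i → cong₂ _*_ (f≈f′ i) (g≈g′ (m ∸ i)))

  ⊛-suc : ∀ f g m → (f ⊛ g) (suc m) ≡ f 0 * g (suc m) + (tl f ⊛ g) m
  ⊛-suc f g m = sumℤ-peel m (λ i → f i * g (suc m ∸ i))

  C-⊛ : ∀ c g m → (C c ⊛ g) m ≡ c * g m
  C-⊛ c g zero    = refl
  C-⊛ c g (suc m) = begin
    (C c ⊛ g) (suc m)                ≡⟨ ⊛-suc (C c) g m ⟩
    c * g (suc m) + (tl (C c) ⊛ g) m ≡⟨ cong (_+_ (c * g (suc m))) (sumℤ-zero m _ (λ _ → refl)) ⟩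
    c * g (suc m) + + 0              ≡⟨ ℤ.+-identityʳ _ ⟩
    c * g (suc m)                    ∎

  ⊛-distribˡ : ∀ f g h → f ⊛ (g ⊕ h) ≈ f ⊛ g ⊕ f ⊛ h
  ⊛-distribˡ f g h m =
    trans (sumℤ-cong m (λ i → ℤ.*-distribˡ-+ (f i) (g (m ∸ i)) (h (m ∸ i)))) (sumℤ-+ m _ _)

  ⊛-distribʳ : ∀ f g h → (g ⊕ h) ⊛ f ≈ g ⊛ f ⊕ h ⊛ f
  ⊛-distribʳ f g h m =
    trans (sumℤ-cong m (λ i → ℤ.*-distribʳ-+ (f (m ∸ i)) (g i) (h i))) (sumℤ-+ m _ _)

  ⊛-comm : ∀ f g → f ⊛ g ≈ g ⊛ f
  ⊛-comm f g zero          = ℤ.*-comm (f 0) (g 0)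
  ⊛-comm f g (suc zero)    =
    solve 4 (λ a b c d → a :* b :+ c :* d := d :* c :+ b :* a) refl (f 0) (g 1) (f 1) (g 0)
  ⊛-comm f g (suc (suc m)) = begin
    (f ⊛ g) (suc (suc m))
      ≡⟨ ⊛-suc f g (suc m) ⟩
    f 0 * g (suc (suc m)) + (tl f ⊛ g) (suc m)
      ≡⟨ cong (_+_ (f 0 * g (suc (suc m)))) (trans (⊛-comm (tl f) g (suc m)) (⊛-suc g (tl f) m)) ⟩
    f 0 * g (suc (suc m)) + (g 0 * f (suc (suc m)) + (tl g ⊛ tl f) m)
      ≡⟨ cong (λ x → f 0 * g (suc (suc m)) + (g 0 * f (suc (suc m)) + x)) (⊛-comm (tl g) (tl f) m) ⟩
    f 0 * g (suc (suc m)) + (g 0 * f (suc (suc m)) + (tl f ⊛ tl g) m)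
      ≡⟨ solve 3 (λ a b c → a :+ (b :+ c) := b :+ (a :+ c)) refl
           (f 0 * g (suc (suc m))) (g 0 * f (suc (suc m))) ((tl f ⊛ tl g) m) ⟩
    g 0 * f (suc (suc m)) + (f 0 * g (suc (suc m)) + (tl f ⊛ tl g) m)
      ≡⟨ cong (_+_ (g 0 * f (suc (suc m)))) (sym (trans (⊛-comm (tl g) f (suc m)) (⊛-suc f (tl g) m))) ⟩
    g 0 * f (suc (suc m)) + (tl g ⊛ f) (suc m)
      ≡⟨ sym (⊛-suc g f (suc m)) ⟩
    (g ⊛ f) (suc (suc m))
      ∎

  ⊛-assoc : ∀ f g h → (f ⊛ g) ⊛ h ≈ f ⊛ (g ⊛ h)
  ⊛-assoc f g h zero    = ℤ.*-assoc (f 0) (g 0) (h 0)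
  ⊛-assoc f g h (suc m) = begin
    ((f ⊛ g) ⊛ h) (suc m)
      ≡⟨ ⊛-suc (f ⊛ g) h m ⟩
    (f 0 * g 0) * h (suc m) + (tl (f ⊛ g) ⊛ h) m
      ≡⟨ cong (_+_ ((f 0 * g 0) * h (suc m))) (trans (⊛-cong {g = h} (⊛-suc f g) (λ _ → refl) m)
           (⊛-distribʳ h (λ i → f 0 * tl g i) (tl f ⊛ g) m)) ⟩
    (f 0 * g 0) * h (suc m) + (((λ i → f 0 * tl g i) ⊛ h) m + ((tl f ⊛ g) ⊛ h) m)
      ≡⟨ cong₂ (λ u v → (f 0 * g 0) * h (suc m) + (u + v))
           (trans (sumℤ-cong m (λ i → ℤ.*-assoc (f 0) (g (suc i)) (h (m ∸ i))))
                  (sumℤ-*ˡ m (f 0) (λ i → g (suc i) * h (m ∸ i))))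
           (⊛-assoc (tl f) g h m) ⟩
    (f 0 * g 0) * h (suc m) + (f 0 * (tl g ⊛ h) m + (tl f ⊛ (g ⊛ h)) m)
      ≡⟨ solve 5 (λ a b c d e → (a :* b) :* c :+ (a :* d :+ e) := a :* (b :* c :+ d) :+ e) refl
           (f 0) (g 0) (h (suc m)) ((tl g ⊛ h) m) ((tl f ⊛ (g ⊛ h)) m) ⟩
    f 0 * (g 0 * h (suc m) + (tl g ⊛ h) m) + (tl f ⊛ (g ⊛ h)) m
      ≡⟨ cong (λ x → f 0 * x + (tl f ⊛ (g ⊛ h)) m) (sym (⊛-suc g h m)) ⟩
    f 0 * (g ⊛ h) (suc m) + (tl f ⊛ (g ⊛ h)) m
      ≡⟨ sym (⊛-suc f (g ⊛ h) m) ⟩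
    (f ⊛ (g ⊛ h)) (suc m)
      ∎

open CauchyProduct using (C-zero; ⊛-cong; ⊛-suc; C-⊛; ⊛-comm)
open import Data.Nat using (_+_; _*_)
open import Data.Nat.Tactic.RingSolver using () renaming (solve to solve-ℕ)

⊕-cong : ∀ {f f′ g g′} → f ≈ f′ → g ≈ g′ → f ⊕ g ≈ f′ ⊕ g′
⊕-cong f≈f′ g≈g′ m = cong₂ ℤ._+_ (f≈f′ m) (g≈g′ m)

⊖-cong : ∀ {f f′ g g′} → f ≈ f′ → g ≈ g′ → f ⊖ g ≈ f′ ⊖ g′
⊖-cong f≈f′ g≈g′ m = cong₂ ℤ._-_ (f≈f′ m) (g≈g′ m)

-- Congruences with the unchanged operand explicit: Agda cannot infer it through the unfolded ⊛.
⊛-congˡ : ∀ {f f′} g → f ≈ f′ → f ⊛ g ≈ f′ ⊛ g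
⊛-congˡ g f≈f′ = ⊛-cong {g = g} {g′ = g} f≈f′ (λ _ → refl)

⊛-congʳ : ∀ f {g g′} → g ≈ g′ → f ⊛ g ≈ f ⊛ g′
⊛-congʳ f g≈g′ = ⊛-cong {f} {f} (λ _ → refl) g≈g′

⊕-congˡ : ∀ {f f′} g → f ≈ f′ → f ⊕ g ≈ f′ ⊕ g
⊕-congˡ g f≈f′ = ⊕-cong {g = g} {g′ = g} f≈f′ (λ _ → refl)

⊕-congʳ : ∀ f {g g′} → g ≈ g′ → f ⊕ g ≈ f ⊕ g′
⊕-congʳ f g≈g′ = ⊕-cong {f} {f} (λ _ → refl) g≈g′

≈-isEquivalence : IsEquivalence _≈_
≈-isEquivalence = record
  { refl  = λ _ → refl
  ; sym   = λ f≈g m → ≡.sym (f≈g m)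
  ; trans = λ f≈g g≈h m → ≡.trans (f≈g m) (g≈h m)
  }

series-isCommutativeRing : IsCommutativeRing _≈_ _⊕_ _⊛_ neg (C (+ 0)) (C (+ 1))
series-isCommutativeRing = record
  { isRing = record
    { +-isAbelianGroup = record
      { isGroup = record
        { isMonoid = record
          { isSemigroup = record
            { isMagma = record { isEquivalence = ≈-isEquivalence ; ∙-cong = ⊕-cong }
            ; assoc   = λ f g h m → ℤ.+-assoc (f m) (g m) (h m) }
          ; identity = (λ f m → ≡.trans (cong (ℤ._+ f m) (C-zero m)) (ℤ.+-identityˡ (f m)))
                     , (λ f m → ≡.trans (cong (ℤ._+_ (f m)) (C-zero m)) (ℤ.+-identityʳ (f m))) }
        ; inverse = (λ f m → ≡.trans (ℤ.+-inverseˡ (f m)) (≡.sym (C-zero m)))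
                  , (λ f m → ≡.trans (ℤ.+-inverseʳ (f m)) (≡.sym (C-zero m)))
        ; ⁻¹-cong = λ f≈g m → cong ℤ.-_ (f≈g m) }
      ; comm = λ f g m → ℤ.+-comm (f m) (g m) }
    ; *-cong     = ⊛-cong
    ; *-assoc    = CauchyProduct.⊛-assoc
    ; *-identity = (λ g m → ≡.trans (C-⊛ (+ 1) g m) (ℤ.*-identityˡ (g m)))
                 , (λ g m → ≡.trans (⊛-comm g (C (+ 1)) m) (≡.trans (C-⊛ (+ 1) g m) (ℤ.*-identityˡ (g m))))
    ; distrib    = CauchyProduct.⊛-distribˡ , CauchyProduct.⊛-distribʳ }
  ; *-comm = ⊛-comm }

series-commutativeRing : CommutativeRing _ _
series-commutativeRing = record { isCommutativeRing = series-isCommutativeRing }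

C-* : ∀ a b → C (a ℤ.* b) ≈ C a ⊛ C b
C-* a b zero    = refl
C-* a b (suc m) = ≡.sym (≡.trans (C-⊛ a (C b) (suc m)) (ℤ.*-zeroʳ a))

C-homomorphism : ℤ.+-*-rawRing ACR.-Raw-AlmostCommutative⟶ ACR.fromCommutativeRing series-commutativeRing
C-homomorphism = record
  { ⟦_⟧    = C
  ; +-homo = λ { a b zero → refl ; a b (suc m) → refl }
  ; *-homo = C-*
  ; -‿homo = λ { a zero → refl ; a (suc m) → refl }
  ; 0-homo = λ _ → refl
  ; 1-homo = λ _ → refl
  }

C-≟ : ∀ a b → Maybe (C a ≈ C b)
C-≟ a b with a ℤ.≟ b
... | yes refl = just (λ _ → refl)
... | no  _    = nothing

open RingSolver ℤ.+-*-rawRing (ACR.fromCommutativeRing series-commutativeRing) C-homomorphism C-≟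
  using (solve; _:=_; _:+_; _:-_; _:*_; :-_; con)
open CommutativeRing series-commutativeRing using (setoid)
  renaming (refl to ≈-refl; reflexive to ≈-reflexive; sym to ≈-sym; trans to ≈-trans)
open SetoidReasoning setoid

0# : Series
0# = C (+ 0)

S-⊛-suc : ∀ g m → (S ⊛ g) (suc m) ≡ g m
S-⊛-suc g m = ≡.trans (⊛-suc S g m) (≡.trans (cong (ℤ._+_ (+ 0)) tlS-⊛) (ℤ.+-identityˡ (g m)))
  where
  tlS≈1 : tl S ≈ C (+ 1)
  tlS≈1 zero    = refl
  tlS≈1 (suc _) = refl
  tlS-⊛ : (tl S ⊛ g) m ≡ g m
  tlS-⊛ = ≡.trans (⊛-congˡ g tlS≈1 m) (≡.trans (C-⊛ (+ 1) g m) (ℤ.*-identityˡ (g m)))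

S-⊛-tl : ∀ g → g 0 ≡ + 0 → S ⊛ tl g ≈ g
S-⊛-tl g g₀≡0 zero    = ≡.sym g₀≡0
S-⊛-tl g g₀≡0 (suc m) = S-⊛-suc (tl g) m

-- Cancellation in ℤ[[s]]

NonZeroDivisor : Series → Set
NonZeroDivisor f = ∀ g → f ⊛ g ≈ 0# → g ≈ 0#

nzd-cancelˡ : ∀ {f} g h → NonZeroDivisor f → f ⊛ g ≈ f ⊛ h → g ≈ h
nzd-cancelˡ {f} g h nzd fg≈fh m = ℤ.i-j≡0⇒i≡j (g m) (h m) (≡.trans (g-h≈0 m) (C-zero m))
  where
  g-h≈0 : g ⊖ h ≈ 0#
  g-h≈0 = nzd (g ⊖ h) (begin
    f ⊛ (g ⊖ h)     ≈⟨ solve 3 (λ x y z → x :* (y :- z) := x :* y :- x :* z) (λ _ → refl) f g h ⟩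
    f ⊛ g ⊖ f ⊛ h   ≈⟨ ⊖-cong fg≈fh ≈-refl ⟩
    f ⊛ h ⊖ f ⊛ h   ≈⟨ solve 1 (λ x → x :- x := con (+ 0)) (λ _ → refl) (f ⊛ h) ⟩
    0#              ∎)

nzd-⊛ : ∀ {f g} → NonZeroDivisor f → NonZeroDivisor g → NonZeroDivisor (f ⊛ g)
nzd-⊛ {f} {g} nzd-f nzd-g h fgh≈0 =
  nzd-g h (nzd-f (g ⊛ h) (≈-trans (≈-sym (CauchyProduct.⊛-assoc f g h)) fgh≈0))

nzd-resp-≈ : ∀ {f f′} → f ≈ f′ → NonZeroDivisor f → NonZeroDivisor f′
nzd-resp-≈ f≈f′ nzd g f′g≈0 = nzd g (≈-trans (⊛-congˡ g f≈f′) f′g≈0)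

nzd-S : NonZeroDivisor S
nzd-S g Sg≈0 m = ≡.trans (≡.sym (S-⊛-suc g m)) (≡.trans (Sg≈0 (suc m)) (≡.sym (C-zero m)))

nzd-constantTerm : ∀ f → f 0 ≢ + 0 → NonZeroDivisor f
nzd-constantTerm f f₀≢0 g fg≈0 m = ≡.trans (vanishes m g fg≈0) (≡.sym (C-zero m))
  where
  constantTerm-vanishes : ∀ g → f ⊛ g ≈ 0# → g 0 ≡ + 0
  constantTerm-vanishes g fg≈0 with ℤ.i*j≡0⇒i≡0∨j≡0 (f 0) (fg≈0 0)
  ... | inj₁ f₀≡0 = ⊥-elim (f₀≢0 f₀≡0)
  ... | inj₂ g₀≡0 = g₀≡0
  -- Once g 0 = 0, g = s · tl g and s can be cancelled, so tl g is annihilated by f as well.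
  vanishes : ∀ m g → f ⊛ g ≈ 0# → g m ≡ + 0
  vanishes zero    g fg≈0 = constantTerm-vanishes g fg≈0
  vanishes (suc m) g fg≈0 = vanishes m (tl g) (nzd-S (f ⊛ tl g) (begin
    S ⊛ (f ⊛ tl g)   ≈⟨ solve 3 (λ s x y → s :* (x :* y) := x :* (s :* y)) (λ _ → refl) S f (tl g) ⟩
    f ⊛ (S ⊛ tl g)   ≈⟨ ⊛-congʳ f (S-⊛-tl g (constantTerm-vanishes g fg≈0)) ⟩
    f ⊛ g            ≈⟨ fg≈0 ⟩
    0#               ∎))

nzd-coefficient : ∀ f m → f m ≢ + 0 → NonZeroDivisor f
nzd-coefficient f zero    f₀≢0 = nzd-constantTerm f f₀≢0
nzd-coefficient f (suc m) fₘ≢0 with f 0 ℤ.≟ + 0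
... | no  f₀≢0 = nzd-constantTerm f f₀≢0
... | yes f₀≡0 = nzd-resp-≈ (S-⊛-tl f f₀≡0) (nzd-⊛ {S} {tl f} nzd-S (nzd-coefficient (tl f) m fₘ≢0))

brace-vanishes : ∀ n m → n ≤ m → brace n m ≡ + 0
brace-vanishes zero          m       _         = C-zero m
brace-vanishes (suc zero)    (suc m) _         = refl
brace-vanishes (suc (suc n)) (suc m) (s≤s n<m) =
  cong₂ ℤ._-_ (≡.trans (S-⊛-suc (brace (suc n)) m) (brace-vanishes (suc n) m n<m))
              (brace-vanishes n (suc m) (ℕ.m≤n⇒m≤1+n (ℕ.<⇒≤ n<m)))

brace-leading : ∀ n → brace (suc n) n ≡ + 1
brace-leading zero    = refl
brace-leading (suc n) =
  cong₂ ℤ._-_ (≡.trans (S-⊛-suc (brace (suc n)) n) (brace-leading n))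
              (brace-vanishes n (suc n) (ℕ.n≤1+n n))

nzd-brace : ∀ n → NonZeroDivisor (brace (suc n))
nzd-brace n = nzd-coefficient (brace (suc n)) n (λ bₙ≡0 → +1≢0 (≡.trans (≡.sym (brace-leading n)) bₙ≡0))
  where
  +1≢0 : + 1 ≢ + 0
  +1≢0 ()

nzd-braceFact : ∀ n → NonZeroDivisor (braceFact n)
nzd-braceFact zero    = nzd-constantTerm (C (+ 1)) (λ ())
nzd-braceFact (suc n) = nzd-⊛ {braceFact n} {brace (suc n)} (nzd-braceFact n) (nzd-brace n)

-- With {n} = (αⁿ - βⁿ)/(α - β), ⟨n⟩ = αⁿ + βⁿ and αβ = 1, the discriminant (α - β)² = s² - 4
-- turns a product of two braces into a difference of Lucas polynomials.

discriminant : Series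
discriminant = S ⊛ S ⊖ C (+ 4)

nzd-discriminant : NonZeroDivisor discriminant
nzd-discriminant = nzd-constantTerm discriminant (λ ())

luc≈brace-brace : ∀ n → luc (suc n) ≈ brace (suc (suc n)) ⊖ brace n
luc≈brace-brace zero          =
  solve 1 (λ s → s := s :* con (+ 1) :- con (+ 0) :- con (+ 0)) (λ _ → refl) S
luc≈brace-brace (suc zero)    =
  solve 1 (λ s → s :* s :- con (+ 2) := s :* (s :* con (+ 1) :- con (+ 0)) :- con (+ 1) :- con (+ 1))
    (λ _ → refl) S
luc≈brace-brace (suc (suc n)) = begin
  S ⊛ luc (suc (suc n)) ⊖ luc (suc n)
    ≈⟨ ⊖-cong (⊛-congʳ S (luc≈brace-brace (suc n))) (luc≈brace-brace n) ⟩
  S ⊛ (brace (3 + n) ⊖ brace (suc n)) ⊖ (brace (2 + n) ⊖ brace n)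
    ≈⟨ solve 5 (λ s b₃ b₂ b₁ b₀ → s :* (b₃ :- b₁) :- (b₂ :- b₀)
                                 := (s :* b₃ :- b₂) :- (s :* b₁ :- b₀))
         (λ _ → refl) S (brace (3 + n)) (brace (2 + n)) (brace (suc n)) (brace n) ⟩
  brace (4 + n) ⊖ brace (2 + n)
    ∎

discriminant-brace : ∀ n → discriminant ⊛ brace (suc n) ≈ luc (suc (suc n)) ⊖ luc n
discriminant-brace zero          =
  solve 1 (λ s → (s :* s :- con (+ 4)) :* con (+ 1) := (s :* s :- con (+ 2)) :- con (+ 2)) (λ _ → refl) S
discriminant-brace (suc zero)    =
  solve 1 (λ s → (s :* s :- con (+ 4)) :* (s :* con (+ 1) :- con (+ 0)) := (s :* (s :* s :- con (+ 2)) :- s) :- s)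
    (λ _ → refl) S
discriminant-brace (suc (suc n)) = begin
  discriminant ⊛ (S ⊛ brace (2 + n) ⊖ brace (suc n))
    ≈⟨ solve 4 (λ d s b₁ b₀ → d :* (s :* b₁ :- b₀) := s :* (d :* b₁) :- d :* b₀)
         (λ _ → refl) discriminant S (brace (2 + n)) (brace (suc n)) ⟩
  S ⊛ (discriminant ⊛ brace (2 + n)) ⊖ discriminant ⊛ brace (suc n)
    ≈⟨ ⊖-cong (⊛-congʳ S (discriminant-brace (suc n))) (discriminant-brace n) ⟩
  S ⊛ (luc (3 + n) ⊖ luc (suc n)) ⊖ (luc (2 + n) ⊖ luc n)
    ≈⟨ solve 5 (λ s l₃ l₂ l₁ l₀ → s :* (l₃ :- l₁) :- (l₂ :- l₀)
                                 := (s :* l₃ :- l₂) :- (s :* l₁ :- l₀))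
         (λ _ → refl) S (luc (3 + n)) (luc (2 + n)) (luc (suc n)) (luc n) ⟩
  luc (4 + n) ⊖ luc (2 + n)
    ∎

-- Reindexings for an induction step from m + 1 and m to m + 2 in which n shifts.
private
  module DoubleStepIndices (m n : ℕ) where
    e₁ : 2 + m + n ≡ suc m + suc n
    e₁ = solve-ℕ (m ∷ n ∷ [])
    e₂ : 2 + m + n ≡ m + (2 + n)
    e₂ = solve-ℕ (m ∷ n ∷ [])
    e₃ : suc m + (suc m + suc n) ≡ suc (m + (m + (2 + n)))
    e₃ = solve-ℕ (m ∷ n ∷ [])
    e₄ : 2 + (m + (m + (2 + n))) ≡ 2 + m + (2 + m + n)
    e₄ = solve-ℕ (m ∷ n ∷ [])

discriminant-brace-brace : ∀ m n → discriminant ⊛ brace m ⊛ brace (m + n) ≈ luc (m + (m + n)) ⊖ luc n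
discriminant-brace-brace zero          n =
  solve 3 (λ d b l → d :* con (+ 0) :* b := l :- l) (λ _ → refl) discriminant (brace n) (luc n)
discriminant-brace-brace (suc zero)    n = ≈-trans
  (solve 2 (λ d b → d :* con (+ 1) :* b := d :* b) (λ _ → refl) discriminant (brace (suc n)))
  (discriminant-brace n)
discriminant-brace-brace (suc (suc m)) n = begin
  D ⊛ (S ⊛ brace (suc m) ⊖ brace m) ⊛ brace (2 + m + n)
    ≈⟨ solve 5 (λ d s b₁ b₀ x → d :* (s :* b₁ :- b₀) :* x := s :* (d :* b₁ :* x) :- d :* b₀ :* x)
         (λ _ → refl) D S (brace (suc m)) (brace m) (brace (2 + m + n)) ⟩
  S ⊛ (D ⊛ brace (suc m) ⊛ brace (2 + m + n)) ⊖ D ⊛ brace m ⊛ brace (2 + m + n)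
    ≡⟨ cong₂ (λ i j → S ⊛ (D ⊛ brace (suc m) ⊛ brace i) ⊖ D ⊛ brace m ⊛ brace j) e₁ e₂ ⟩
  S ⊛ (D ⊛ brace (suc m) ⊛ brace (suc m + suc n)) ⊖ D ⊛ brace m ⊛ brace (m + (2 + n))
    ≈⟨ ⊖-cong (⊛-congʳ S (discriminant-brace-brace (suc m) (suc n)))
              (discriminant-brace-brace m (2 + n)) ⟩
  S ⊛ (luc (suc m + (suc m + suc n)) ⊖ luc (suc n)) ⊖ (luc K ⊖ luc (2 + n))
    ≡⟨ cong (λ i → S ⊛ (luc i ⊖ luc (suc n)) ⊖ (luc K ⊖ luc (2 + n))) e₃ ⟩
  S ⊛ (luc (suc K) ⊖ luc (suc n)) ⊖ (luc K ⊖ (S ⊛ luc (suc n) ⊖ luc n))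
    ≈⟨ solve 5 (λ s a₁ a₀ c₁ c₀ → s :* (a₁ :- c₁) :- (a₀ :- (s :* c₁ :- c₀))
                                 := (s :* a₁ :- a₀) :- c₀)
         (λ _ → refl) S (luc (suc K)) (luc K) (luc (suc n)) (luc n) ⟩
  luc (2 + K) ⊖ luc n
    ≡⟨ cong (λ i → luc i ⊖ luc n) e₄ ⟩
  luc (2 + m + (2 + m + n)) ⊖ luc n
    ∎
  where
  D = discriminant
  K = m + (m + (2 + n))
  open DoubleStepIndices m n

luc⊛brace : ∀ m n → luc (m + n) ⊛ brace m ⊕ brace n ≈ brace (m + (m + n))
luc⊛brace zero          n =
  solve 2 (λ l b → l :* con (+ 0) :+ b := b) (λ _ → refl) (luc n) (brace n)
luc⊛brace (suc zero)    n = begin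
  luc (suc n) ⊛ C (+ 1) ⊕ brace n
    ≈⟨ ⊕-congˡ (brace n) (≈-trans (solve 1 (λ l → l :* con (+ 1) := l) (λ _ → refl) (luc (suc n)))
                                  (luc≈brace-brace n)) ⟩
  brace (2 + n) ⊖ brace n ⊕ brace n
    ≈⟨ solve 2 (λ x y → x :- y :+ y := x) (λ _ → refl) (brace (2 + n)) (brace n) ⟩
  brace (2 + n)
    ∎
luc⊛brace (suc (suc m)) n = begin
  X ⊛ (S ⊛ brace (suc m) ⊖ brace m) ⊕ brace n
    ≈⟨ solve 6 (λ x s b₁ b₀ c₁ c₀ → x :* (s :* b₁ :- b₀) :+ c₀
                                   := s :* (x :* b₁ :+ c₁) :- (x :* b₀ :+ (s :* c₁ :- c₀)))
         (λ _ → refl) X S (brace (suc m)) (brace m) (brace (suc n)) (brace n) ⟩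
  S ⊛ (X ⊛ brace (suc m) ⊕ brace (suc n)) ⊖ (X ⊛ brace m ⊕ brace (2 + n))
    ≡⟨ cong₂ (λ i j → S ⊛ (luc i ⊛ brace (suc m) ⊕ brace (suc n)) ⊖ (luc j ⊛ brace m ⊕ brace (2 + n)))
             e₁ e₂ ⟩
  S ⊛ (luc (suc m + suc n) ⊛ brace (suc m) ⊕ brace (suc n)) ⊖ (luc (m + (2 + n)) ⊛ brace m ⊕ brace (2 + n))
    ≈⟨ ⊖-cong (⊛-congʳ S (luc⊛brace (suc m) (suc n))) (luc⊛brace m (2 + n)) ⟩
  S ⊛ brace (suc m + (suc m + suc n)) ⊖ brace K
    ≡⟨ cong (λ i → S ⊛ brace i ⊖ brace K) e₃ ⟩
  brace (2 + K)
    ≡⟨ cong brace e₄ ⟩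
  brace (2 + m + (2 + m + n))
    ∎
  where
  X = luc (2 + m + n)
  K = m + (m + (2 + n))
  open DoubleStepIndices m n

brace-vajda : ∀ a b → brace (suc (a + b)) ⊛ brace (2 + a + b)
                      ≈ brace (suc b + suc (a + a)) ⊛ brace (suc b) ⊕ brace a ⊛ brace (suc a)
brace-vajda a b = nzd-cancelˡ {discriminant} _ _ nzd-discriminant (begin
  D ⊛ (brace (suc (a + b)) ⊛ brace (2 + a + b))
    ≈⟨ solve 3 (λ d x y → d :* (x :* y) := d :* x :* y) (λ _ → refl)
         D (brace (suc (a + b))) (brace (2 + a + b)) ⟩
  D ⊛ brace (suc (a + b)) ⊛ brace (2 + a + b)
    ≡⟨ cong (λ i → D ⊛ brace (suc (a + b)) ⊛ brace i) i₁ ⟩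
  D ⊛ brace (suc (a + b)) ⊛ brace (suc (a + b) + 1)
    ≈⟨ discriminant-brace-brace (suc (a + b)) 1 ⟩
  luc (suc (a + b) + (suc (a + b) + 1)) ⊖ luc 1
    ≡⟨ cong (λ i → luc i ⊖ luc 1) i₂ ⟩
  luc P ⊖ luc 1
    ≈⟨ solve 3 (λ x y z → x :- z := (x :- y) :+ (y :- z)) (λ _ → refl) (luc P) (luc (suc (a + a))) (luc 1) ⟩
  (luc P ⊖ luc (suc (a + a))) ⊕ (luc (suc (a + a)) ⊖ luc 1)
    ≡⟨ cong (λ i → (luc P ⊖ luc (suc (a + a))) ⊕ (luc i ⊖ luc 1)) i₃ ⟩
  (luc P ⊖ luc (suc (a + a))) ⊕ (luc (a + (a + 1)) ⊖ luc 1)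
    ≈⟨ ⊕-cong (≈-sym (discriminant-brace-brace (suc b) (suc (a + a)))) (≈-sym (discriminant-brace-brace a 1)) ⟩
  D ⊛ brace (suc b) ⊛ brace (suc b + suc (a + a)) ⊕ D ⊛ brace a ⊛ brace (a + 1)
    ≡⟨ cong (λ i → D ⊛ brace (suc b) ⊛ brace (suc b + suc (a + a)) ⊕ D ⊛ brace a ⊛ brace i)
            (ℕ.+-comm a 1) ⟩
  D ⊛ brace (suc b) ⊛ brace (suc b + suc (a + a)) ⊕ D ⊛ brace a ⊛ brace (suc a)
    ≈⟨ solve 5 (λ d y₁ y₂ z₁ z₂ → d :* y₁ :* y₂ :+ d :* z₁ :* z₂
                                 := d :* (y₂ :* y₁ :+ z₁ :* z₂))
         (λ _ → refl) D (brace (suc b)) (brace (suc b + suc (a + a))) (brace a) (brace (suc a)) ⟩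
  D ⊛ (brace (suc b + suc (a + a)) ⊛ brace (suc b) ⊕ brace a ⊛ brace (suc a))
    ∎)
  where
  D = discriminant
  P = suc b + (suc b + suc (a + a))
  i₁ : 2 + a + b ≡ suc (a + b) + 1
  i₁ = solve-ℕ (a ∷ b ∷ [])
  i₂ : suc (a + b) + (suc (a + b) + 1) ≡ suc b + (suc b + suc (a + a))
  i₂ = solve-ℕ (a ∷ b ∷ [])
  i₃ : suc (a + a) ≡ a + (a + 1)
  i₃ = solve-ℕ (a ∷ [])

brace-three-term : ∀ a b →
  brace b ⊛ brace (suc b) ⊕ luc (suc (a + b)) ⊛ brace (suc a) ⊛ brace (suc b) ⊕ brace (suc a) ⊛ brace a
  ≈ brace (suc (a + b)) ⊛ brace (2 + a + b)
brace-three-term a b = begin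
  brace b ⊛ brace (suc b) ⊕ T ⊛ brace (suc b) ⊕ brace (suc a) ⊛ brace a
    ≈⟨ solve 5 (λ x y t u v → x :* y :+ t :* y :+ u :* v := (t :+ x) :* y :+ v :* u)
         (λ _ → refl) (brace b) (brace (suc b)) T (brace (suc a)) (brace a) ⟩
  (T ⊕ brace b) ⊛ brace (suc b) ⊕ brace a ⊛ brace (suc a)
    ≈⟨ ⊕-cong (⊛-congˡ (brace (suc b)) (luc⊛brace (suc a) b)) ≈-refl ⟩
  brace (suc a + (suc a + b)) ⊛ brace (suc b) ⊕ brace a ⊛ brace (suc a)
    ≡⟨ cong (λ i → brace i ⊛ brace (suc b) ⊕ brace a ⊛ brace (suc a)) i ⟩
  brace (suc b + suc (a + a)) ⊛ brace (suc b) ⊕ brace a ⊛ brace (suc a)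
    ≈⟨ ≈-sym (brace-vajda a b) ⟩
  brace (suc (a + b)) ⊛ brace (2 + a + b)
    ∎
  where
  T = luc (suc (a + b)) ⊛ brace (suc a)
  i : suc a + (suc a + b) ≡ suc b + suc (a + a)
  i = solve-ℕ (a ∷ b ∷ [])

-- The lucanomials via their three-term recurrence

shiftUp : (ℕ → Series) → ℕ → Series
shiftUp F zero    = 0#
shiftUp F (suc k) = F k

lucanomial : ℕ → ℕ → Series
lucanomial zero          zero          = C (+ 1)
lucanomial zero          (suc k)       = 0#
lucanomial (suc zero)    zero          = C (+ 1)
lucanomial (suc zero)    (suc zero)    = C (+ 1)
lucanomial (suc zero)    (suc (suc k)) = 0#
lucanomial (suc (suc n)) k =
  lucanomial n k ⊕ luc (suc n) ⊛ shiftUp (lucanomial n) k ⊕ shiftUp (shiftUp (lucanomial n)) k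

lucanomial-vanishes : ∀ n k → n < k → lucanomial n k ≈ 0#
lucanomial-vanishes zero          (suc k)       _               = ≈-refl
lucanomial-vanishes (suc zero)    (suc zero)    (s≤s ())
lucanomial-vanishes (suc zero)    (suc (suc k)) _               = ≈-refl
lucanomial-vanishes (suc (suc n)) (suc (suc k)) (s≤s (s≤s n<k)) = begin
  lucanomial n (2 + k) ⊕ luc (suc n) ⊛ lucanomial n (suc k) ⊕ lucanomial n k
    ≈⟨ ⊕-cong (⊕-cong (lucanomial-vanishes n (2 + k) (ℕ.m≤n⇒m≤1+n (ℕ.m≤n⇒m≤1+n n<k)))
                       (⊛-congʳ (luc (suc n)) (lucanomial-vanishes n (suc k) (ℕ.m≤n⇒m≤1+n n<k))))
              (lucanomial-vanishes n k n<k) ⟩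
  0# ⊕ luc (suc n) ⊛ 0# ⊕ 0#
    ≈⟨ solve 1 (λ l → con (+ 0) :+ l :* con (+ 0) :+ con (+ 0) := con (+ 0)) (λ _ → refl) (luc (suc n)) ⟩
  0#
    ∎

lucanomial-0 : ∀ n → lucanomial n 0 ≈ C (+ 1)
lucanomial-0 zero          = ≈-refl
lucanomial-0 (suc zero)    = ≈-refl
lucanomial-0 (suc (suc n)) = ≈-trans (⊕-cong (⊕-cong (lucanomial-0 n) ≈-refl) ≈-refl)
  (solve 1 (λ l → con (+ 1) :+ l :* con (+ 0) :+ con (+ 0) := con (+ 1)) (λ _ → refl) (luc (suc n)))

lucanomial-diagonal : ∀ n → lucanomial n n ≈ C (+ 1)
lucanomial-diagonal zero          = ≈-refl
lucanomial-diagonal (suc zero)    = ≈-refl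
lucanomial-diagonal (suc (suc n)) = ≈-trans
  (⊕-cong (⊕-cong (lucanomial-vanishes n (2 + n) (ℕ.m≤n⇒m≤1+n (ℕ.n<1+n n)))
                   (⊛-congʳ (luc (suc n)) (lucanomial-vanishes n (suc n) (ℕ.n<1+n n))))
          (lucanomial-diagonal n))
  (solve 1 (λ l → con (+ 0) :+ l :* con (+ 0) :+ con (+ 1) := con (+ 1)) (λ _ → refl) (luc (suc n)))

private
  F : ℕ → Series
  F = braceFact

braceFact-lucanomial : ∀ k m → F k ⊛ F m ⊛ lucanomial (k + m) k ≈ F (k + m)
braceFact-lucanomial-upper : ∀ k m →
  F (suc k) ⊛ F (suc m) ⊛ lucanomial (k + m) (suc k) ≈ F (k + m) ⊛ (brace m ⊛ brace (suc m))
braceFact-lucanomial-lower : ∀ k m →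
  F (suc k) ⊛ F (suc m) ⊛ shiftUp (lucanomial (k + m)) k ≈ F (k + m) ⊛ (brace (suc k) ⊛ brace k)

braceFact-lucanomial zero    m    = ≈-trans (⊛-congʳ (C (+ 1) ⊛ F m) (lucanomial-0 m))
  (solve 1 (λ x → con (+ 1) :* x :* con (+ 1) := x) (λ _ → refl) (F m))
braceFact-lucanomial (suc k) zero rewrite ℕ.+-identityʳ k =
  ≈-trans (⊛-congʳ (F (suc k) ⊛ C (+ 1)) (lucanomial-diagonal (suc k)))
  (solve 1 (λ x → x :* con (+ 1) :* con (+ 1) := x) (λ _ → refl) (F (suc k)))
braceFact-lucanomial (suc k) (suc m) rewrite ℕ.+-suc k m = begin
  F k ⊛ brace (suc k) ⊛ (F m ⊛ brace (suc m)) ⊛ (B (suc k) ⊕ L ⊛ B k ⊕ shiftUp (lucanomial n) k)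
    ≈⟨ solve 8 (λ fk bk fm bm x l y z → fk :* bk :* (fm :* bm) :* (x :+ l :* y :+ z)
                  := fk :* bk :* (fm :* bm) :* x :+ (fk :* fm :* y) :* (l :* bk :* bm) :+ fk :* bk :* (fm :* bm) :* z)
         (λ _ → refl) (F k) (brace (suc k)) (F m) (brace (suc m)) (B (suc k)) L (B k) (shiftUp (lucanomial n) k) ⟩
  F (suc k) ⊛ F (suc m) ⊛ B (suc k) ⊕ (F k ⊛ F m ⊛ B k) ⊛ (L ⊛ brace (suc k) ⊛ brace (suc m))
    ⊕ F (suc k) ⊛ F (suc m) ⊛ shiftUp (lucanomial n) k
    ≈⟨ ⊕-cong (⊕-cong (braceFact-lucanomial-upper k m)
                       (⊛-congˡ (L ⊛ brace (suc k) ⊛ brace (suc m)) (braceFact-lucanomial k m)))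
              (braceFact-lucanomial-lower k m) ⟩
  F n ⊛ (brace m ⊛ brace (suc m)) ⊕ F n ⊛ (L ⊛ brace (suc k) ⊛ brace (suc m))
    ⊕ F n ⊛ (brace (suc k) ⊛ brace k)
    ≈⟨ solve 4 (λ f x y z → f :* x :+ f :* y :+ f :* z := f :* (x :+ y :+ z)) (λ _ → refl)
         (F n) (brace m ⊛ brace (suc m)) (L ⊛ brace (suc k) ⊛ brace (suc m)) (brace (suc k) ⊛ brace k) ⟩
  F n ⊛ (brace m ⊛ brace (suc m) ⊕ L ⊛ brace (suc k) ⊛ brace (suc m) ⊕ brace (suc k) ⊛ brace k)
    ≈⟨ ⊛-congʳ (F n) (brace-three-term k m) ⟩
  F n ⊛ (brace (suc n) ⊛ brace (2 + n))
    ≈⟨ solve 3 (λ f x y → f :* (x :* y) := f :* x :* y) (λ _ → refl) (F n) (brace (suc n)) (brace (2 + n)) ⟩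
  F (2 + n)
    ∎
  where
  n = k + m
  B = lucanomial n
  L = luc (suc n)

braceFact-lucanomial-upper k zero    = begin
  F (suc k) ⊛ F 1 ⊛ lucanomial (k + 0) (suc k)
    ≈⟨ ⊛-congʳ (F (suc k) ⊛ F 1)
         (lucanomial-vanishes (k + 0) (suc k) (s≤s (ℕ.≤-reflexive (ℕ.+-identityʳ k)))) ⟩
  F (suc k) ⊛ F 1 ⊛ 0#
    ≈⟨ solve 3 (λ x y z → x :* con (+ 0) := y :* (con (+ 0) :* z)) (λ _ → refl)
         (F (suc k) ⊛ F 1) (F (k + 0)) (brace 1) ⟩
  F (k + 0) ⊛ (brace 0 ⊛ brace 1)
    ∎
braceFact-lucanomial-upper k (suc m) rewrite ℕ.+-suc k m = begin
  F (suc k) ⊛ (F m ⊛ brace (suc m) ⊛ brace (2 + m)) ⊛ B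
    ≈⟨ solve 5 (λ f g x y b → f :* (g :* x :* y) :* b := f :* g :* b :* (x :* y)) (λ _ → refl)
         (F (suc k)) (F m) (brace (suc m)) (brace (2 + m)) B ⟩
  F (suc k) ⊛ F m ⊛ B ⊛ (brace (suc m) ⊛ brace (2 + m))
    ≈⟨ ⊛-congˡ (brace (suc m) ⊛ brace (2 + m)) (braceFact-lucanomial (suc k) m) ⟩
  F (suc k + m) ⊛ (brace (suc m) ⊛ brace (2 + m))
    ∎
  where
  B = lucanomial (suc k + m) (suc k)

braceFact-lucanomial-lower zero    m = solve 3 (λ x y z → x :* con (+ 0) := y :* (z :* con (+ 0))) (λ _ → refl)
  (F 1 ⊛ F (suc m)) (F m) (brace 1)
braceFact-lucanomial-lower (suc k) m = begin
  F k ⊛ brace (suc k) ⊛ brace (2 + k) ⊛ F (suc m) ⊛ B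
    ≈⟨ solve 5 (λ f x y g b → f :* x :* y :* g :* b := f :* g :* b :* (y :* x)) (λ _ → refl)
         (F k) (brace (suc k)) (brace (2 + k)) (F (suc m)) B ⟩
  F k ⊛ F (suc m) ⊛ B ⊛ (brace (2 + k) ⊛ brace (suc k))
    ≈⟨ ⊛-congˡ (brace (2 + k) ⊛ brace (suc k))
         (≡.subst (λ n → F k ⊛ F (suc m) ⊛ lucanomial n k ≈ F n) (ℕ.+-suc k m)
                  (braceFact-lucanomial k (suc m))) ⟩
  F (suc k + m) ⊛ (brace (2 + k) ⊛ brace (suc k))
    ∎
  where
  B = lucanomial (suc k + m) k

isLucanomial⇒≈lucanomial : ∀ L → IsLucanomial L → ∀ n k → k ≤ n → L n k ≈ lucanomial n k
isLucanomial⇒≈lucanomial L isL n k k≤n =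
  nzd-cancelˡ {F k ⊛ F (n ∸ k)} (L n k) (lucanomial n k)
    (nzd-⊛ {F k} {F (n ∸ k)} (nzd-braceFact k) (nzd-braceFact (n ∸ k)))
    (≈-trans (isL n k k≤n) (≈-sym (≡.subst (λ j → F k ⊛ F (n ∸ k) ⊛ lucanomial j k ≈ F j)
                                          (ℕ.m+[n∸m]≡n k≤n)
                                          (braceFact-lucanomial k (n ∸ k)))))

sumS-cong≤ : ∀ n {F G : ℕ → Series} → (∀ k → k ≤ n → F k ≈ G k) → sumS n F ≈ sumS n G
sumS-cong≤ zero    F≈G = F≈G 0 z≤n
sumS-cong≤ (suc n) F≈G =
  ⊕-cong (sumS-cong≤ n (λ k k≤n → F≈G k (ℕ.m≤n⇒m≤1+n k≤n))) (F≈G (suc n) ℕ.≤-refl)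

sumS-peel : ∀ n (F : ℕ → Series) → sumS (suc n) F ≈ F 0 ⊕ sumS n (λ k → F (suc k))
sumS-peel zero    F = ≈-refl
sumS-peel (suc n) F = ≈-trans (⊕-cong (sumS-peel n F) ≈-refl)
  (solve 3 (λ a b c → a :+ b :+ c := a :+ (b :+ c)) (λ _ → refl) (F 0) (sumS n (λ k → F (suc k))) (F (2 + n)))

sumS-⊕ : ∀ n (F G : ℕ → Series) → sumS n (λ k → F k ⊕ G k) ≈ sumS n F ⊕ sumS n G
sumS-⊕ zero    F G = ≈-refl
sumS-⊕ (suc n) F G = ≈-trans (⊕-cong (sumS-⊕ n F G) ≈-refl)
  (solve 4 (λ a b c d → a :+ b :+ (c :+ d) := a :+ c :+ (b :+ d)) (λ _ → refl)
     (sumS n F) (sumS n G) (F (suc n)) (G (suc n)))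

sumS-⊛ : ∀ n X (F : ℕ → Series) → sumS n (λ k → X ⊛ F k) ≈ X ⊛ sumS n F
sumS-⊛ zero    X F = ≈-refl
sumS-⊛ (suc n) X F = ≈-trans (⊕-cong (sumS-⊛ n X F) ≈-refl)
  (solve 3 (λ x a b → x :* a :+ x :* b := x :* (a :+ b)) (λ _ → refl) X (sumS n F) (F (suc n)))

sumS-dropLast : ∀ n (F : ℕ → Series) → F (suc n) ≈ 0# → sumS (suc n) F ≈ sumS n F
sumS-dropLast n F Fₙ₊₁≈0 = ≈-trans (⊕-congʳ (sumS n F) Fₙ₊₁≈0)
  (solve 1 (λ a → a :+ con (+ 0) := a) (λ _ → refl) (sumS n F))

-- Row sums Σₖ w(k) {n k}

weightedSum : (ℕ → ℤ) → ℕ → Series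
weightedSum w n = sumS n (λ k → C (w k) ⊛ lucanomial n k)

sumS-shiftUp : ∀ n (w : ℕ → ℤ) (F : ℕ → Series) →
  sumS (suc n) (λ k → C (w k) ⊛ shiftUp F k) ≈ sumS n (λ k → C (w (suc k)) ⊛ F k)
sumS-shiftUp n w F = ≈-trans (sumS-peel n (λ k → C (w k) ⊛ shiftUp F k))
  (solve 2 (λ c a → c :* con (+ 0) :+ a := a) (λ _ → refl) (C (w 0)) (sumS n (λ k → C (w (suc k)) ⊛ F k)))

weightedSum-step : ∀ w n → weightedSum w (2 + n)
  ≈ weightedSum w n ⊕ luc (suc n) ⊛ weightedSum (λ k → w (suc k)) n ⊕ weightedSum (λ k → w (2 + k)) n
weightedSum-step w n = begin
  sumS (2 + n) (λ k → C (w k) ⊛ (B k ⊕ L ⊛ shiftUp B k ⊕ shiftUp (shiftUp B) k))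
    ≈⟨ sumS-cong≤ (2 + n) (λ k _ →
         solve 5 (λ c b l x y → c :* (b :+ l :* x :+ y) := c :* b :+ l :* (c :* x) :+ c :* y)
           (λ _ → refl) (C (w k)) (B k) L (shiftUp B k) (shiftUp (shiftUp B) k)) ⟩
  sumS (2 + n) (λ k → C (w k) ⊛ B k ⊕ L ⊛ (C (w k) ⊛ shiftUp B k) ⊕ C (w k) ⊛ shiftUp (shiftUp B) k)
    ≈⟨ ≈-trans (sumS-⊕ (2 + n) (λ k → C (w k) ⊛ B k ⊕ L ⊛ (C (w k) ⊛ shiftUp B k)) S₂)
               (⊕-congˡ (sumS (2 + n) S₂)
                 (≈-trans (sumS-⊕ (2 + n) S₀ (λ k → L ⊛ S₁ k))
                          (⊕-congʳ (sumS (2 + n) S₀) (sumS-⊛ (2 + n) L S₁)))) ⟩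
  sumS (2 + n) (λ k → C (w k) ⊛ B k) ⊕ L ⊛ sumS (2 + n) (λ k → C (w k) ⊛ shiftUp B k)
    ⊕ sumS (2 + n) (λ k → C (w k) ⊛ shiftUp (shiftUp B) k)
    ≈⟨ ⊕-cong (⊕-cong dropTwo (⊛-congʳ L shiftOnce)) shiftTwice ⟩
  weightedSum w n ⊕ L ⊛ weightedSum (λ k → w (suc k)) n ⊕ weightedSum (λ k → w (2 + k)) n
    ∎
  where
  B = lucanomial n
  L = luc (suc n)
  S₀ S₁ S₂ : ℕ → Series
  S₀ k = C (w k) ⊛ B k
  S₁ k = C (w k) ⊛ shiftUp B k
  S₂ k = C (w k) ⊛ shiftUp (shiftUp B) k
  vanishing : ∀ (v : ℕ → ℤ) k → n < k → C (v k) ⊛ B k ≈ 0#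
  vanishing v k n<k = ≈-trans (⊛-congʳ (C (v k)) (lucanomial-vanishes n k n<k))
    (solve 1 (λ c → c :* con (+ 0) := con (+ 0)) (λ _ → refl) (C (v k)))
  dropTwo : sumS (2 + n) (λ k → C (w k) ⊛ B k) ≈ weightedSum w n
  dropTwo = ≈-trans (sumS-dropLast (suc n) _ (vanishing w (2 + n) (ℕ.m≤n⇒m≤1+n (ℕ.n<1+n n))))
                    (sumS-dropLast n _ (vanishing w (suc n) (ℕ.n<1+n n)))
  shiftOnce : sumS (2 + n) (λ k → C (w k) ⊛ shiftUp B k) ≈ weightedSum (λ k → w (suc k)) n
  shiftOnce = ≈-trans (sumS-shiftUp (suc n) w B)
                      (sumS-dropLast n _ (vanishing (λ k → w (suc k)) (suc n) (ℕ.n<1+n n)))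
  shiftTwice : sumS (2 + n) (λ k → C (w k) ⊛ shiftUp (shiftUp B) k) ≈ weightedSum (λ k → w (2 + k)) n
  shiftTwice = ≈-trans (sumS-shiftUp (suc n) w (shiftUp B)) (sumS-shiftUp n (λ k → w (suc k)) B)

weightedSum-geometric : ∀ w c → (∀ k → w (suc k) ≡ c ℤ.* w k) →
  ∀ n → weightedSum (λ k → w (suc k)) n ≈ C c ⊛ weightedSum w n
weightedSum-geometric w c w-geometric n = begin
  sumS n (λ k → C (w (suc k)) ⊛ lucanomial n k)
    ≈⟨ sumS-cong≤ n (λ k _ → ⊛-congˡ (lucanomial n k)
         (≈-trans (≈-reflexive (cong C (w-geometric k))) (C-* c (w k)))) ⟩
  sumS n (λ k → C c ⊛ C (w k) ⊛ lucanomial n k)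
    ≈⟨ sumS-cong≤ n (λ k _ → CauchyProduct.⊛-assoc (C c) (C (w k)) (lucanomial n k)) ⟩
  sumS n (λ k → C c ⊛ (C (w k) ⊛ lucanomial n k))
    ≈⟨ sumS-⊛ n (C c) (λ k → C (w k) ⊛ lucanomial n k) ⟩
  C c ⊛ weightedSum w n
    ∎

prod1-cong : ∀ N {F G : ℕ → Series} → (∀ i → F i ≈ G i) → prod1 N F ≈ prod1 N G
prod1-cong zero    F≈G = ≈-refl
prod1-cong (suc N) F≈G = ⊛-cong (prod1-cong N F≈G) (F≈G (suc N))

prod1-peel : ∀ N (F : ℕ → Series) → prod1 (suc N) F ≈ F 1 ⊛ prod1 N (λ i → F (suc i))
prod1-peel zero    F = solve 1 (λ x → con (+ 1) :* x := x :* con (+ 1)) (λ _ → refl) (F 1)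
prod1-peel (suc N) F = ≈-trans (⊛-congˡ (F (2 + N)) (prod1-peel N F))
  (solve 3 (λ a b c → a :* b :* c := a :* (b :* c)) (λ _ → refl) (F 1) (prod1 N (λ i → F (suc i))) (F (2 + N)))

lucasProduct : (Series → Series) → ℕ → Series
lucasProduct φ n = prod1 ⌊ n /2⌋ (λ i → φ (luc (n ∸ 2 * i + 1)))

lucasProduct-step : ∀ φ n → lucasProduct φ (2 + n) ≈ φ (luc (suc n)) ⊛ lucasProduct φ n
lucasProduct-step φ n = ≈-trans (prod1-peel ⌊ n /2⌋ (λ i → φ (luc (2 + n ∸ 2 * i + 1))))
  (⊛-cong (≈-reflexive (cong (λ j → φ (luc j)) (ℕ.+-comm n 1)))
          (prod1-cong ⌊ n /2⌋ (λ i → ≈-reflexive (cong (λ j → φ (luc (2 + n ∸ j + 1))) (ℕ.*-suc 2 i)))))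

rowSum-formula : ∀ n → weightedSum (λ _ → + 1) n ≈ C (+ 1 ℤ.+ δO n) ⊛ lucasProduct (C (+ 2) ⊕_) n
rowSum-formula zero          = ≈-refl
rowSum-formula (suc zero)    =
  solve 0 (con (+ 1) :* con (+ 1) :+ con (+ 1) :* con (+ 1) := con (+ 2) :* con (+ 1)) (λ _ → refl)
rowSum-formula (suc (suc n)) = begin
  W (2 + n)
    ≈⟨ weightedSum-step (λ _ → + 1) n ⟩
  W n ⊕ L ⊛ W n ⊕ W n
    ≈⟨ solve 2 (λ x l → x :+ l :* x :+ x := (con (+ 2) :+ l) :* x) (λ _ → refl) (W n) L ⟩
  (C (+ 2) ⊕ L) ⊛ W n
    ≈⟨ ⊛-congʳ (C (+ 2) ⊕ L) (rowSum-formula n) ⟩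
  (C (+ 2) ⊕ L) ⊛ (C κ ⊛ P n)
    ≈⟨ solve 3 (λ a b c → a :* (b :* c) := b :* (a :* c)) (λ _ → refl) (C (+ 2) ⊕ L) (C κ) (P n) ⟩
  C κ ⊛ ((C (+ 2) ⊕ L) ⊛ P n)
    ≈⟨ ⊛-congʳ (C κ) (≈-sym (lucasProduct-step (C (+ 2) ⊕_) n)) ⟩
  C κ ⊛ P (2 + n)
    ∎
  where
  W = weightedSum (λ _ → + 1)
  P = lucasProduct (C (+ 2) ⊕_)
  L = luc (suc n)
  κ = + 1 ℤ.+ δO n

sgn-suc : ∀ k → sgn (suc k) ≡ -[1+ 0 ] ℤ.* sgn k
sgn-suc zero          = refl
sgn-suc (suc zero)    = refl
sgn-suc (suc (suc k)) = sgn-suc k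

alternatingRowSum-formula : ∀ n → weightedSum sgn n ≈ C (δE n) ⊛ lucasProduct (C (+ 2) ⊖_) n
alternatingRowSum-formula zero          = ≈-refl
alternatingRowSum-formula (suc zero)    =
  solve 0 (con (+ 1) :* con (+ 1) :+ con -[1+ 0 ] :* con (+ 1) := con (+ 0) :* con (+ 1)) (λ _ → refl)
alternatingRowSum-formula (suc (suc n)) = begin
  W (2 + n)
    ≈⟨ weightedSum-step sgn n ⟩
  W n ⊕ L ⊛ weightedSum (λ k → sgn (suc k)) n ⊕ W n
    ≈⟨ ⊕-congˡ (W n) (⊕-congʳ (W n) (⊛-congʳ L (weightedSum-geometric sgn -[1+ 0 ] sgn-suc n))) ⟩
  W n ⊕ L ⊛ (C -[1+ 0 ] ⊛ W n) ⊕ W n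
    ≈⟨ solve 2 (λ x l → x :+ l :* (con -[1+ 0 ] :* x) :+ x := (con (+ 2) :- l) :* x) (λ _ → refl) (W n) L ⟩
  (C (+ 2) ⊖ L) ⊛ W n
    ≈⟨ ⊛-congʳ (C (+ 2) ⊖ L) (alternatingRowSum-formula n) ⟩
  (C (+ 2) ⊖ L) ⊛ (C (δE n) ⊛ P n)
    ≈⟨ solve 3 (λ a b c → a :* (b :* c) := b :* (a :* c)) (λ _ → refl) (C (+ 2) ⊖ L) (C (δE n)) (P n) ⟩
  C (δE n) ⊛ ((C (+ 2) ⊖ L) ⊛ P n)
    ≈⟨ ⊛-congʳ (C (δE n)) (≈-sym (lucasProduct-step (C (+ 2) ⊖_) n)) ⟩
  C (δE n) ⊛ P (2 + n)
    ∎
  where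
  W = weightedSum sgn
  P = lucasProduct (C (+ 2) ⊖_)
  L = luc (suc n)

corollary5p4 : (L : ℕ → ℕ → Series) → IsLucanomial L →
    ∀ n → 1 ≤ n →
      (sumS n (λ k → L n k)
        ≈ C (+ 1 ℤ.+ δO n) ⊛ prod1 ⌊ n /2⌋ (λ i → C (+ 2) ⊕ luc (n ∸ 2 * i + 1)))
      ×
      (sumS n (λ k → C (sgn k) ⊛ L n k)
        ≈ C (δE n) ⊛ prod1 ⌊ n /2⌋ (λ i → C (+ 2) ⊖ luc (n ∸ 2 * i + 1)))
corollary5p4 L isL n _ =
    ≈-trans (sumS-cong≤ n (λ k k≤n → ≈-trans (L≈lucanomial k k≤n) (≈-sym (*-identityˡ (lucanomial n k)))))
            (rowSum-formula n)
  , ≈-trans (sumS-cong≤ n (λ k k≤n → ⊛-congʳ (C (sgn k)) (L≈lucanomial k k≤n)))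
            (alternatingRowSum-formula n)
  where
  L≈lucanomial : ∀ k → k ≤ n → L n k ≈ lucanomial n k
  L≈lucanomial = isLucanomial⇒≈lucanomial L isL n
  open CommutativeRing series-commutativeRing using (*-identityˡ)
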